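{- Let $(A_n,\varphi_n^m)$ be a fine projective sequence of finite $\mathcal L_R$-structures with projective limit $\mathbb A$, projections $\varphi_n:\mathbb A\to A_n$, and quotient map $p:\mathbb A\to\mathbb A/R^{\mathbb A}$. The following are equivalent: (1) the set of points of $\mathbb A$ whose $R^{\mathbb A}$-equivalence class is a singleton is dense in $\mathbb A$; (2) for each $n$ and $a\in A_n$ there are $m>n$ and $b\in A_m$ such that every $b'\in A_m$ with $b'\,R^{A_m}\,b$ satisfies $\varphi_n^m(b')=a$; (3) $p$ is irreducible.
   Context: $\mathcal L_R$ is a relational language containing a distinguished binary relation symbol $R$; $R^{A_n}$ is reflexive and symmetric in each $A_n$. Finite structures are discrete. An epimorphism $\varphi:A\to B$ is a continuous surjection with $r^B=(\varphi\times\cdots\times\varphi)[r^A]$ for each relation symbol $r$. A projective sequence $(A_n,\varphi_n^m)$ has epimorphisms $\varphi_n^{n+1}:A_{n+1}\to A_n$ with compositions $\varphi_n^m$; its projective limit is $\mathbb A=\{u\in\prod_nA_n:u(n)=\varphi_n^{n+1}(u(n+1))\}$ with product topology, $r^{\mathbb A}$ holding iff it holds coordinatewise, and $\varphi_n(u)=u(n)$. The sequence is fine if $R^{\mathbb A}$ is an equivalence relation (it is then closed). A continuous map $f:X\to Z$ is irreducible if $f[K]\ne Z$ for all proper closed $K\subsetneq X$. -}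

module Defs where

open import Data.Nat using (ℕ; zero; suc; _+_)
open import Data.Fin using (Fin)
open import Data.Product using (Σ; ∃; ∃-syntax; _×_; _,_; proj₁)
open import Relation.Nullary using (¬_)
open import Relation.Binary.PropositionalEquality using (_≡_)
open import Relation.Binary.Structures using (IsEquivalence)
open import Function using (_⇔_)

-- A relational language L_R: a set of further relation symbols with
-- arities, together with the distinguished binary symbol R (treated
-- separately below).
record Lang : Set₁ where
  field
    Sym : Set
    ar  : Sym → ℕ

-- A finite L_R-structure.  The universe is (up to isomorphism) Fin size,
-- discrete topology.  R is reflexive and symmetric.
record Structure (L : Lang) : Set₁ where
  open Lang L
  field
    size : ℕ
    rel  : (s : Sym) → (Fin (ar s) → Fin size) → Set
    R    : Fin size → Fin size → Set
    R-refl : ∀ a → R a a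
    R-sym  : ∀ a b → R a b → R b a

open Structure public

Carrier : {L : Lang} → Structure L → Set
Carrier A = Fin (size A)

-- Epimorphism f : A → B (continuity is automatic: discrete spaces).
-- r^B = (f × ... × f)[r^A] for every symbol r, including R.
record IsEpi {L : Lang} (A B : Structure L) (f : Carrier A → Carrier B) : Set where
  open Lang L
  field
    surj  : ∀ b → ∃[ a ] f a ≡ b
    rel-image : ∀ (s : Sym) (y : Fin (ar s) → Carrier B) →
      rel B s y ⇔ (∃[ x ] (rel A s x × (∀ i → f (x i) ≡ y i)))
    R-image : ∀ (b b' : Carrier B) →
      R B b b' ⇔ (∃[ a ] ∃[ a' ] (R A a a' × f a ≡ b × f a' ≡ b'))

record ProjSeq (L : Lang) : Set₁ where
  field
    A   : ℕ → Structure L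
    φ   : ∀ n → Carrier (A (suc n)) → Carrier (A n)
    φ-epi : ∀ n → IsEpi (A (suc n)) (A n) (φ n)

  -- φ_n^m for m = d + n :  A_{d+n} → A_n
  φ^ : ∀ n d → Carrier (A (d + n)) → Carrier (A n)
  φ^ n zero x = x
  φ^ n (suc d) x = φ^ n d (φ (d + n) x)

  Point : Set
  Point = Σ ((n : ℕ) → Carrier (A n)) λ u → ∀ n → u n ≡ φ n (u (suc n))

  π : (n : ℕ) → Point → Carrier (A n)
  π n u = proj₁ u n

  R𝔸 : Point → Point → Set
  R𝔸 u v = ∀ n → R (A n) (π n u) (π n v)

  _≈_ : Point → Point → Set
  u ≈ v = ∀ n → π n u ≡ π n v

  -- product topology: generated by the cylinders φ_n^{-1}(a)
  Cyl : (n : ℕ) → Carrier (A n) → Point → Set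
  Cyl n a u = π n u ≡ a

  IsOpen : (Point → Set) → Set
  IsOpen U = ∀ u → U u → ∃[ n ] (∀ v → Cyl n (π n u) v → U v)

  IsClosed : (Point → Set) → Set
  IsClosed K = IsOpen (λ u → ¬ K u)

  Dense : (Point → Set) → Set₁
  Dense D = ∀ U → IsOpen U → (∃[ u ] U u) → ∃[ u ] (U u × D u)

  Fine : Set
  Fine = IsEquivalence R𝔸

  SingletonClass : Point → Set
  SingletonClass u = ∀ v → R𝔸 v u → v ≈ u

  -- image of K under the quotient map p : 𝔸 → 𝔸/R^𝔸 is all of 𝔸/R^𝔸
  pImageFull : (Point → Set) → Set
  pImageFull K = ∀ u → ∃[ v ] (K v × R𝔸 v u)

  pIrreducible : Set₁
  pIrreducible = ∀ (K : Point → Set) → IsClosed K → ¬ (∀ u → K u) → ¬ pImageFull K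

  Cond1 : Set₁
  Cond1 = Dense SingletonClass

  -- (2) with m = suc d + n > n
  Cond2 : Set
  Cond2 = ∀ n (a : Carrier (A n)) → ∃[ d ] ∃[ b ]
            (∀ (b' : Carrier (A (suc d + n))) → R (A (suc d + n)) b' b → φ^ n (suc d) b' ≡ a)

{-# OPTIONS --safe #-}
-- If a ∈ A_n admits no b as in (2), then for every u ∈ 𝔸 the x ∈ A_m that are
-- R-related to φ_m(u) and whose cylinder is not contained in that of a form a
-- downward closed family of nonempty finite sets, which König's lemma threads
-- into some v with v R u and φ_n(v) ≠ a.  Hence no point over a has a
-- singleton class, and the closed set {φ_n ≠ a} meets every class, so (1) and
-- (3) both fail.  Conversely, (2) refines any cylinder along a cofinal chain of
-- levels, at each of which the R-neighbourhood of the chosen point is pushed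
-- onto one point; the limit of the chain has a singleton class.  This gives
-- (1), and (3) because a closed set missing such a point misses its class.
module Submission where

open import Defs
open import Level using (0ℓ)
open import Axiom.ExcludedMiddle using (ExcludedMiddle)
open import Axiom.DoubleNegationElimination using (DoubleNegationElimination; em⇒dne)
open import Data.Nat using (ℕ; zero; suc; _+_; _≤_; _⊔_; _≤′_; ≤′-refl; ≤′-step)
open import Data.Nat.Properties
  using (n≮n; ≤′⇒≤; ≤⇒≤′; ≤′-trans; z≤′n; s≤′s; m≤′m+n; n≤′m+n; m≤m⊔n; m≤n⇒m≤o⊔n)
open import Data.Fin using (Fin)
open import Data.Product using (Σ; ∃; ∃-syntax; _×_; _,_; proj₁; proj₂; map₂)
open import Function using (_∘_; _⇔_; mk⇔; Equivalence)
open import Relation.Nullary using (¬_; contradiction)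
open import Relation.Binary.Definitions using (Irrelevant)
open import Relation.Binary.PropositionalEquality
  using (_≡_; _≢_; refl; sym; trans; cong; subst; module ≡-Reasoning)

≤′-irrelevant : Irrelevant _≤′_
≤′-irrelevant ≤′-refl     ≤′-refl     = refl
≤′-irrelevant ≤′-refl     (≤′-step q) = contradiction (≤′⇒≤ q) (n≮n _)
≤′-irrelevant (≤′-step p) ≤′-refl     = contradiction (≤′⇒≤ p) (n≮n _)
≤′-irrelevant (≤′-step p) (≤′-step q) = cong ≤′-step (≤′-irrelevant p q)

finite-bounded : ∀ {k} (f : Fin k → ℕ) → ∃[ E ] ∀ x → f x ≤ E
finite-bounded {zero}  f = 0 , λ ()
finite-bounded {suc k} f with finite-bounded (f ∘ Fin.suc)
... | E , bounded = f Fin.zero ⊔ E , λ where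
  Fin.zero    → m≤m⊔n (f Fin.zero) E
  (Fin.suc x) → m≤n⇒m≤o⊔n (f Fin.zero) (bounded x)

module Classical (dne : DoubleNegationElimination 0ℓ) where

  ¬∀⇒∃¬ : {X : Set} {P : X → Set} → ¬ (∀ x → P x) → ∃[ x ] ¬ P x
  ¬∀⇒∃¬ ¬all = dne λ ¬ex → ¬all λ x → dne λ ¬Px → ¬ex (x , ¬Px)

  -- Each x fails P x at some height; above the largest of these finitely
  -- many heights no x satisfies P, against the covering hypothesis.
  antitone-pigeonhole : ∀ {k} (P : Fin k → ℕ → Set) → (∀ x L → P x (suc L) → P x L) →
    (∀ L → ∃[ x ] P x L) → ∃[ x ] ∀ L → P x L
  antitone-pigeonhole P antitone cover = dne λ none →
    let failure : ∀ x → ∃[ L ] ¬ P x L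
        failure x = ¬∀⇒∃¬ λ all → none (x , all)
        E , bounded = finite-bounded (proj₁ ∘ failure)
        x , PxE = cover E
    in proj₂ (failure x) (descend x (≤⇒≤′ (bounded x)) PxE)
    where
    descend : ∀ x {L L'} → L' ≤′ L → P x L → P x L'
    descend x ≤′-refl     p = p
    descend x (≤′-step q) p = descend x q (antitone x _ p)

module Limit {L : Lang} (S : ProjSeq L) where
  open ProjSeq S

  proj : ∀ {j k} → j ≤′ k → Carrier (A k) → Carrier (A j)
  proj ≤′-refl           x = x
  proj (≤′-step {k} p) x = proj p (φ k x)

  proj-irrelevant : ∀ {j k} (p q : j ≤′ k) x → proj p x ≡ proj q x
  proj-irrelevant p q x rewrite ≤′-irrelevant p q = refl

  proj-≤′-trans : ∀ {i j k} (p : i ≤′ j) (q : j ≤′ k) x → proj (≤′-trans p q) x ≡ proj p (proj q x)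
  proj-≤′-trans p ≤′-refl           x = refl
  proj-≤′-trans p (≤′-step {k} q) x = proj-≤′-trans p q (φ k x)

  proj-∘ : ∀ {i j k} (p : i ≤′ j) (q : j ≤′ k) (r : i ≤′ k) x → proj r x ≡ proj p (proj q x)
  proj-∘ p q r x = trans (proj-irrelevant r (≤′-trans p q) x) (proj-≤′-trans p q x)

  φ^≡proj : ∀ n d x → φ^ n d x ≡ proj (n≤′m+n d n) x
  φ^≡proj n zero    x = refl
  φ^≡proj n (suc d) x = φ^≡proj n d (φ (d + n) x)

  π-proj : ∀ {j k} (u : Point) (p : j ≤′ k) → π j u ≡ proj p (π k u)
  π-proj u ≤′-refl           = refl
  π-proj u (≤′-step {k} p) = trans (π-proj u p) (cong (proj p) (proj₂ u k))

  π-φ^ : ∀ n d (u : Point) → π n u ≡ φ^ n d (π (d + n) u)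
  π-φ^ n zero    u = refl
  π-φ^ n (suc d) u = trans (π-φ^ n d u) (cong (φ^ n d) (proj₂ u (d + n)))

  R-φ : ∀ {k x y} → R (A (suc k)) x y → R (A k) (φ k x) (φ k y)
  R-φ {k} {x} {y} r =
    Equivalence.from (IsEpi.R-image (φ-epi k) (φ k x) (φ k y)) (x , y , r , refl , refl)

  ≈-from-cofinal : ∀ {m : ℕ → ℕ} → (∀ j → j ≤′ m j) → ∀ {v w} →
    (∀ k → π (m k) v ≡ π (m k) w) → v ≈ w
  ≈-from-cofinal cofinal {v} {w} agree j = begin
    π j v                        ≡⟨ π-proj v (cofinal j) ⟩
    proj (cofinal j) (π _ v)     ≡⟨ cong (proj (cofinal j)) (agree j) ⟩
    proj (cofinal j) (π _ w)     ≡⟨ sym (π-proj w (cofinal j)) ⟩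
    π j w                        ∎
    where open ≡-Reasoning

  chain-limit : ∀ {m : ℕ → ℕ} (step : ∀ k → m k ≤′ m (suc k)) (cofinal : ∀ j → j ≤′ m j)
    (b : ∀ k → Carrier (A (m k))) → (∀ k → proj (step k) (b (suc k)) ≡ b k) →
    ∃[ u ] ∀ k → π (m k) u ≡ b k
  chain-limit {m} step cofinal b compatible = (coord , coherent) , λ k →
    trans (proj-irrelevant (cofinal (m k)) (along (cofinal k)) (b (m k))) (proj-along (cofinal k))
    where
    along : ∀ {k i} → k ≤′ i → m k ≤′ m i
    along ≤′-refl           = ≤′-refl
    along (≤′-step {i} p) = ≤′-trans (along p) (step i)

    proj-along : ∀ {k i} (p : k ≤′ i) → proj (along p) (b i) ≡ b k
    proj-along ≤′-refl           = refl
    proj-along (≤′-step {i} p) = begin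
      proj (≤′-trans (along p) (step i)) (b (suc i)) ≡⟨ proj-≤′-trans (along p) (step i) _ ⟩
      proj (along p) (proj (step i) (b (suc i)))     ≡⟨ cong (proj (along p)) (compatible i) ⟩
      proj (along p) (b i)                           ≡⟨ proj-along p ⟩
      b _                                            ∎
      where open ≡-Reasoning

    coord : ∀ j → Carrier (A j)
    coord j = proj (cofinal j) (b j)

    coherent : ∀ j → coord j ≡ φ j (coord (suc j))
    coherent j = begin
      proj (cofinal j) (b j)
        ≡⟨ cong (proj (cofinal j)) (sym (compatible j)) ⟩
      proj (cofinal j) (proj (step j) (b (suc j)))
        ≡⟨ sym (proj-∘ (cofinal j) (step j) r (b (suc j))) ⟩
      proj r (b (suc j))
        ≡⟨ proj-∘ (≤′-step ≤′-refl) (cofinal (suc j)) r (b (suc j)) ⟩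
      φ j (proj (cofinal (suc j)) (b (suc j)))
        ∎
      where
      open ≡-Reasoning
      r : j ≤′ m (suc j)
      r = ≤′-trans (cofinal j) (step j)

  π-surjective : ∀ {n} (a : Carrier (A n)) → ∃[ u ] π n u ≡ a
  π-surjective {n} a =
    map₂ (λ over → over 0) (chain-limit (λ _ → ≤′-step ≤′-refl) (λ j → m≤′m+n j n) lift lifts)
    where
    lift : ∀ k → Carrier (A (k + n))
    lift zero    = a
    lift (suc k) = proj₁ (IsEpi.surj (φ-epi (k + n)) (lift k))

    lifts : ∀ k → φ (k + n) (lift (suc k)) ≡ lift k
    lifts k = proj₂ (IsEpi.surj (φ-epi (k + n)) (lift k))

  cylinder-⊆⇒φ^≡ : ∀ {n} d {x : Carrier (A (d + n))} {a} →
    (∀ w → π (d + n) w ≡ x → π n w ≡ a) → φ^ n d x ≡ a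
  cylinder-⊆⇒φ^≡ {n} d {x} {a} inside =
    let w , w↦x = π-surjective x in begin
      φ^ n d x             ≡⟨ cong (φ^ n d) (sym w↦x) ⟩
      φ^ n d (π (d + n) w) ≡⟨ sym (π-φ^ n d w) ⟩
      π n w                ≡⟨ inside w w↦x ⟩
      a                    ∎
    where open ≡-Reasoning

  cylinder-open : ∀ {n} (a : Carrier (A n)) → IsOpen (Cyl n a)
  cylinder-open {n} a u ua = n , λ v vu → trans vu ua

  cylinder-complement-closed : ∀ {n} (a : Carrier (A n)) → IsClosed (λ u → ¬ Cyl n a u)
  cylinder-complement-closed {n} a u ¬¬ua = n , λ v vu v≢a → ¬¬ua λ ua → v≢a (trans vu ua)

  DownClosed : (∀ m → Carrier (A m) → Set) → Set
  DownClosed T = ∀ m x → T (suc m) x → T m (φ m x)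

  proj-closed : (T : ∀ m → Carrier (A m) → Set) → DownClosed T →
    ∀ {j k} (p : j ≤′ k) {x} → T k x → T j (proj p x)
  proj-closed T closed ≤′-refl           t = t
  proj-closed T closed (≤′-step {k} p) t = proj-closed T closed p (closed k _ t)

  Cond2At : (n : ℕ) → Carrier (A n) → Set
  Cond2At n a = ∃[ d ] ∃[ b ]
    (∀ (b' : Carrier (A (suc d + n))) → R (A (suc d + n)) b' b → φ^ n (suc d) b' ≡ a)

  module _ (dne : DoubleNegationElimination 0ℓ) where
    open Classical dne

    -- x is extendable when it has a T-preimage at every level above it; by
    -- the pigeonhole principle such x exist at level 0 and each of them has
    -- an extendable φ-preimage.
    königs-lemma : (T : ∀ m → Carrier (A m) → Set) → DownClosed T → (∀ m → ∃ (T m)) →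
      ∃[ u ] ∀ m → T m (π m u)
    königs-lemma T closed inhabited = (proj₁ ∘ branch , φ-branch) , on-branch
      where
      ExtendsTo : ∀ {m} → Carrier (A m) → ℕ → Set
      ExtendsTo {m} x L = (p : m ≤′ L) → ∃[ y ] (T L y × proj p y ≡ x)

      ExtendsTo-antitone : ∀ {m} (x : Carrier (A m)) L → ExtendsTo x (suc L) → ExtendsTo x L
      ExtendsTo-antitone x L ext p =
        let y , Ty , y↦x = ext (≤′-step p) in φ L y , closed L y Ty , y↦x

      Extendable : ∀ m → Carrier (A m) → Set
      Extendable m x = ∀ L → ExtendsTo x L

      root : ∃ (Extendable 0)
      root = antitone-pigeonhole ExtendsTo ExtendsTo-antitone λ L →
        let y , Ty = inhabited L in proj z≤′n y , λ p → y , Ty , proj-irrelevant p z≤′n y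

      extend : ∀ {m x} → Extendable m x → ∃[ x' ] (φ m x' ≡ x × Extendable (suc m) x')
      extend {m} {x} ext =
        let x' , ok = antitone-pigeonhole (λ x' L → φ m x' ≡ x × ExtendsTo x' L)
                        (λ x' L → map₂ (ExtendsTo-antitone x' L)) cover
        in x' , proj₁ (ok 0) , proj₂ ∘ ok
        where
        cover : ∀ L → ∃[ x' ] (φ m x' ≡ x × ExtendsTo x' L)
        cover L =
          let y , Ty , y↦x = ext (suc m + L) (≤′-trans (≤′-step ≤′-refl) q) in
          proj q y , trans (sym (proj-≤′-trans (≤′-step ≤′-refl) q y)) y↦x ,
          λ p → proj r y , proj-closed T closed r Ty , sym (proj-∘ p r q y)
          where
          q : suc m ≤′ suc m + L
          q = m≤′m+n (suc m) L
          r : L ≤′ suc m + L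
          r = n≤′m+n (suc m) L

      branch : ∀ m → Σ (Carrier (A m)) (Extendable m)
      branch zero    = root
      branch (suc m) = let x' , _ , ext = extend (proj₂ (branch m)) in x' , ext

      φ-branch : ∀ m → proj₁ (branch m) ≡ φ m (proj₁ (branch (suc m)))
      φ-branch m = sym (proj₁ (proj₂ (extend (proj₂ (branch m)))))

      on-branch : ∀ m → T m (proj₁ (branch m))
      on-branch m = let y , Ty , y≡x = proj₂ (branch m) m ≤′-refl in subst (T m) y≡x Ty

    escape : ∀ {n} {a : Carrier (A n)} → ¬ Cond2At n a → ∀ u → ∃[ v ] (R𝔸 v u × π n v ≢ a)
    escape {n} {a} ¬c2 u =
      let v , on-v = königs-lemma Leaving closed inhabited
      in v , proj₁ ∘ on-v , λ va → proj₂ (on-v n) λ w wv → trans wv va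
      where
      -- phrased through cylinders so that it also makes sense below level n
      Leaving : ∀ m → Carrier (A m) → Set
      Leaving m x = R (A m) x (π m u) × ¬ (∀ w → π m w ≡ x → π n w ≡ a)

      closed : DownClosed Leaving
      closed m x (r , ¬inside) =
        subst (R (A m) (φ m x)) (sym (proj₂ u m)) (R-φ r) ,
        λ inside → ¬inside λ w wx → inside w (trans (proj₂ w m) (cong (φ m) wx))

      inhabited : ∀ m → ∃ (Leaving m)
      inhabited m =
        let b' , r , off = witness in
        proj p b' , proj-closed Leaving closed p (r , off ∘ cylinder-⊆⇒φ^≡ (suc m))
        where
        p : m ≤′ suc m + n
        p = ≤′-step (m≤′m+n m n)
        witness : ∃[ b' ] (R (A (suc m + n)) b' (π (suc m + n) u) × φ^ n (suc m) b' ≢ a)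
        witness = dne λ none →
          ¬c2 (m , π (suc m + n) u , λ b' r → dne λ off → none (b' , r , off))

    cond2⇒singleton-in-cylinder : Cond2 → ∀ n a → ∃[ w ] (Cyl n a w × SingletonClass w)
    cond2⇒singleton-in-cylinder c2 n a =
      let w , w-over = chain-limit step cofinal b compatible
      in w , w-over 0 , λ v vw → ≈-from-cofinal cofinal {v} {w} λ k → begin
        π (m k) v                                      ≡⟨ π-φ^ (m k) (suc (gap k)) v ⟩
        φ^ (m k) (suc (gap k)) (π (m (suc k)) v)       ≡⟨ collapses k _ (subst (R (A (m (suc k))) _)
                                                                          (w-over (suc k)) (vw (m (suc k)))) ⟩
        b k                                            ≡⟨ sym (w-over k) ⟩
        π (m k) w                                      ∎
      where
      open ≡-Reasoning
      node : ℕ → Σ ℕ (Carrier ∘ A)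
      node zero    = n , a
      node (suc k) =
        let d , b' , _ = c2 (proj₁ (node k)) (proj₂ (node k)) in suc d + proj₁ (node k) , b'

      m : ℕ → ℕ
      m = proj₁ ∘ node
      b : ∀ k → Carrier (A (m k))
      b = proj₂ ∘ node
      gap : ℕ → ℕ
      gap k = proj₁ (c2 (m k) (b k))

      collapses : ∀ k b' → R (A (m (suc k))) b' (b (suc k)) → φ^ (m k) (suc (gap k)) b' ≡ b k
      collapses k = proj₂ (proj₂ (c2 (m k) (b k)))

      step : ∀ k → m k ≤′ m (suc k)
      step k = n≤′m+n (suc (gap k)) (m k)

      cofinal : ∀ j → j ≤′ m j
      cofinal zero    = z≤′n
      cofinal (suc j) = s≤′s (≤′-trans (cofinal j) (n≤′m+n (gap j) (m j)))

      compatible : ∀ k → proj (step k) (b (suc k)) ≡ b k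
      compatible k = trans (sym (φ^≡proj (m k) (suc (gap k)) (b (suc k))))
                           (collapses k (b (suc k)) (R-refl (A (m (suc k))) (b (suc k))))

    cond2⇒cond1 : Cond2 → Cond1
    cond2⇒cond1 c2 U U-open (u , Uu) =
      let n , U-nbhd = U-open u Uu
          w , wu , singleton = cond2⇒singleton-in-cylinder c2 n (π n u)
      in w , U-nbhd w wu , singleton

    cond1⇒cond2 : Cond1 → Cond2
    cond1⇒cond2 dense n a = dne λ ¬c2 →
      let w , wa , singleton = dense (Cyl n a) (cylinder-open a) (π-surjective a)
          v , vw , va = escape ¬c2 w
      in va (trans (singleton v vw n) wa)

    cond2⇒irreducible : Cond2 → pIrreducible
    cond2⇒irreducible c2 K K-closed proper full =
      let u , ¬Ku = ¬∀⇒∃¬ proper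
          w , ¬Kw , singleton = cond2⇒cond1 c2 (¬_ ∘ K) K-closed (u , ¬Ku)
          v , Kv , vw = full w
          n , ¬K-nbhd = K-closed w ¬Kw
      in ¬K-nbhd v (singleton v vw n) Kv

    irreducible⇒cond2 : pIrreducible → Cond2
    irreducible⇒cond2 irreducible n a = dne λ ¬c2 →
      let u , ua = π-surjective a
      in irreducible (λ v → ¬ Cyl n a v) (cylinder-complement-closed a) (λ all → all u ua)
           λ w → let v , vw , va = escape ¬c2 w in v , va , vw

lemma2p13 : ExcludedMiddle 0ℓ → {L : Lang} (S : ProjSeq L) → ProjSeq.Fine S →
    (ProjSeq.Cond1 S ⇔ ProjSeq.Cond2 S) × (ProjSeq.Cond2 S ⇔ ProjSeq.pIrreducible S)
lemma2p13 em S _ =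
  mk⇔ (cond1⇒cond2 dne) (cond2⇒cond1 dne) , mk⇔ (cond2⇒irreducible dne) (irreducible⇒cond2 dne)
  where
  open Limit S
  dne : DoubleNegationElimination 0ℓ
  dne = em⇒dne em
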